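{- Let $s\in\{3,4\}$ and $F(\mathbf x)=a_1x_1^s+\dots+a_sx_s^s$ with $a_1,\dots,a_s$ positive integers (non-exceptional if $s=4$). Let $L,M,m$ be positive integers with $m<M$. Then $$\#\big(\mathcal S_F\cap(m+M\mathbb N)\cap[0,L^sM^s)\big)\leq r_F(m,M)\,L^s.$$
   Context: $\mathbb N=\{0,1,2,\dots\}$. $\mathcal S_F=\{F(\mathbf x):\mathbf x\in\mathbb N^s\}$ is the set of values of $F$ at nonnegative integer points. $r_F(m,M)$ is the number of $\mathbf x\in(\mathbb Z/M\mathbb Z)^s$ with $F(\mathbf x)\equiv m\pmod M$. A biquadratic form is exceptional if it equals $a(c_1x_{\sigma(1)})^4+b(c_2x_{\sigma(2)})^4+4a(c_3x_{\sigma(3)})^4+4b(c_4x_{\sigma(4)})^4$ for some positive integers $a,b,c_1,\dots,c_4$ and a permutation $\sigma$. -}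

module Defs where

open import Data.Nat using (ℕ; zero; suc; _+_; _*_; _^_; _<_; _%_; NonZero; _≟_)
open import Data.Fin using (Fin; toℕ)
open import Data.Vec using (Vec; []; _∷_; zipWith; lookup; map)
open import Data.List using (List; []; _∷_; length; filter; concatMap; allFin)
import Data.List as List
open import Data.Product using (∃-syntax; _×_; Σ)
open import Data.Unit using (⊤)
open import Data.Fin.Permutation using (Permutation′; _⟨$⟩ʳ_)
open import Relation.Binary.PropositionalEquality using (_≡_)
open import Relation.Nullary using (¬_)

diagForm : (s : ℕ) → Vec ℕ s → Vec ℕ s → ℕ
diagForm s a x = Data.Vec.foldr _ _+_ 0 (zipWith (λ aᵢ xᵢ → aᵢ * xᵢ ^ s) a x)

InValues : (s : ℕ) → Vec ℕ s → ℕ → Set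
InValues s a n = ∃[ x ] diagForm s a x ≡ n

allVecs : (s M : ℕ) → List (Vec (Fin M) s)
allVecs zero M = [] ∷ []
allVecs (suc s) M = concatMap (λ i → List.map (i ∷_) (allVecs s M)) (allFin M)

rF : (s : ℕ) → Vec ℕ s → (m M : ℕ) → .{{NonZero M}} → ℕ
rF s a m M = length (filter (λ x → diagForm s a (map toℕ x) % M ≟ m % M) (allVecs s M))

Exceptional : Vec ℕ 4 → Set
Exceptional coeffs =
  ∃[ a ] ∃[ b ] ∃[ c₁ ] ∃[ c₂ ] ∃[ c₃ ] ∃[ c₄ ] Σ (Permutation′ 4) λ σ →
    (0 < a × 0 < b × 0 < c₁ × 0 < c₂ × 0 < c₃ × 0 < c₄ ×
     ((x : Vec ℕ 4) →
        diagForm 4 coeffs x ≡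
          a * (c₁ * lookup x (σ ⟨$⟩ʳ Fin.zero)) ^ 4
        + b * (c₂ * lookup x (σ ⟨$⟩ʳ Fin.suc Fin.zero)) ^ 4
        + 4 * a * (c₃ * lookup x (σ ⟨$⟩ʳ Fin.suc (Fin.suc Fin.zero))) ^ 4
        + 4 * b * (c₄ * lookup x (σ ⟨$⟩ʳ Fin.suc (Fin.suc (Fin.suc Fin.zero)))) ^ 4))
  where
    import Data.Fin as Fin

NonExceptionalIf4 : (s : ℕ) → Vec ℕ s → Set
NonExceptionalIf4 (suc (suc (suc (suc zero)))) a = ¬ Exceptional a
NonExceptionalIf4 _ _ = ⊤

{-# OPTIONS --safe #-}
-- Every n counted on the left is F(x) for some x ∈ ℕ^s, and since all aᵢ ≥ 1 and
-- F(x) < (LM)^s, every coordinate satisfies xᵢ < LM.  Writing xᵢ = yᵢ + qᵢ M with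
-- 0 ≤ yᵢ < M and 0 ≤ qᵢ < L, the residue vector y is a solution of F(y) ≡ m (mod M),
-- so n lies in the list of values F(y + qM) over the r_F(m,M) solutions y and the
-- L^s choices of q.  Distinct n in that list are at most as many as its entries.
module Submission where

open import Defs
open import Data.Nat using (ℕ; zero; suc; _+_; _*_; _^_; _<_; _≤_; _%_; _/_; _≟_; _<?_; NonZero; z≤n; s≤s)
open import Data.Nat.Properties
open import Data.Nat.DivMod using (m≡m%n+[m/n]*n; [m+kn]%n≡m%n; m%n<n; m<n*o⇒m/o<n; %-distribˡ-+; %-distribˡ-*)
open import Data.Fin using (Fin; toℕ; fromℕ<)
open import Data.Fin.Properties using (toℕ-fromℕ<)
open import Data.Vec using (Vec; []; _∷_; zipWith; foldr)
import Data.Vec as Vec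
open import Data.Vec.Relation.Unary.All using (All; []; _∷_)
open import Data.Vec.Relation.Binary.Pointwise.Inductive using (Pointwise; []; _∷_)
open import Data.List using (List; length; filter; concatMap; allFin)
import Data.List as List
open import Data.List.Properties using (length-++; length-map; length-tabulate; length-removeAt′)
open import Data.List.Relation.Unary.Any using (here; there; index; _─_)
import Data.List.Relation.Unary.Any as Any
import Data.List.Relation.Unary.All as ListAll
open import Data.List.Relation.Unary.AllPairs using ([]; _∷_)
open import Data.List.Relation.Unary.Unique.Propositional using (Unique)
open import Data.List.Membership.Propositional using (_∈_)
open import Data.List.Membership.Propositional.Properties using (∈-map⁺; ∈-concatMap⁺; ∈-filter⁺; ∈-allFin)
open import Data.List.Relation.Binary.Subset.Propositional using (_⊆_)
open import Data.Product using (∃-syntax; ∃₂; _×_; _,_)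
open import Data.Sum using (_⊎_)
open import Function using (_∘_; id)
open import Relation.Nullary using (contradiction; yes; no)
open import Relation.Binary.PropositionalEquality using (_≡_; _≢_; refl; sym; trans; cong; cong₂; subst; module ≡-Reasoning)

module _ {A : Set} where

  ∈-─⁺ : ∀ {x y : A} {ys} (x∈ys : x ∈ ys) → y ∈ ys → x ≢ y → y ∈ (ys ─ x∈ys)
  ∈-─⁺ (here refl) (here refl) x≢y = contradiction refl x≢y
  ∈-─⁺ (here _)    (there y∈ys) _  = y∈ys
  ∈-─⁺ (there _)   (here y≡z) _    = here y≡z
  ∈-─⁺ (there x∈ys) (there y∈ys) x≢y = there (∈-─⁺ x∈ys y∈ys x≢y)

  Unique∧⊆⇒length≤ : ∀ {xs ys : List A} → Unique xs → xs ⊆ ys → length xs ≤ length ys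
  Unique∧⊆⇒length≤ {List.[]} _ _ = z≤n
  Unique∧⊆⇒length≤ {x List.∷ xs} {ys} (x≢xs ∷ xs-unique) xs⊆ys = begin
    suc (length xs)          ≤⟨ s≤s (Unique∧⊆⇒length≤ xs-unique xs⊆ys─x) ⟩
    suc (length (ys ─ x∈ys)) ≡⟨ length-removeAt′ ys (index x∈ys) ⟨
    length ys                ∎
    where
    open ≤-Reasoning
    x∈ys : x ∈ ys
    x∈ys = xs⊆ys (here refl)
    xs⊆ys─x : xs ⊆ (ys ─ x∈ys)
    xs⊆ys─x y∈xs = ∈-─⁺ x∈ys (xs⊆ys (there y∈xs)) (ListAll.lookup x≢xs y∈xs)

length-concatMap-const : ∀ {A B : Set} (f : A → List B) {c} →
  (∀ x → length (f x) ≡ c) → ∀ xs → length (concatMap f xs) ≡ length xs * c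
length-concatMap-const f f-const List.[] = refl
length-concatMap-const f f-const (x List.∷ xs) = trans (length-++ (f x))
  (cong₂ _+_ (f-const x) (length-concatMap-const f f-const xs))

length-allVecs : ∀ s M → length (allVecs s M) ≡ M ^ s
length-allVecs zero M = refl
length-allVecs (suc s) M = begin
  length (allVecs (suc s) M) ≡⟨ length-concatMap-const _ length-row (allFin M) ⟩
  length (allFin M) * M ^ s  ≡⟨ cong (_* M ^ s) (length-tabulate {n = M} id) ⟩
  M * M ^ s                  ∎
  where
  open ≡-Reasoning
  length-row : ∀ i → length (List.map (i ∷_) (allVecs s M)) ≡ M ^ s
  length-row i = trans (length-map (i ∷_) (allVecs s M)) (length-allVecs s M)

∈-allVecs : ∀ {s M} (v : Vec (Fin M) s) → v ∈ allVecs s M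
∈-allVecs [] = here refl
∈-allVecs {suc s} {M} (i ∷ v) = ∈-concatMap⁺ (λ j → List.map (j ∷_) (allVecs s M))
  (Any.map (λ { refl → ∈-map⁺ (i ∷_) (∈-allVecs v) }) (∈-allFin i))

^-distribʳ-* : ∀ l m k → (l * m) ^ k ≡ l ^ k * m ^ k
^-distribʳ-* l m zero = refl
^-distribʳ-* l m (suc k) = begin
  l * m * (l * m) ^ k     ≡⟨ cong (l * m *_) (^-distribʳ-* l m k) ⟩
  l * m * (l ^ k * m ^ k) ≡⟨ [m*n]*[o*p]≡[m*o]*[n*p] l m (l ^ k) (m ^ k) ⟩
  l * l ^ k * (m * m ^ k) ∎
  where open ≡-Reasoning

^-cancelʳ-< : ∀ {m n} k → m ^ k < n ^ k → m < n
^-cancelʳ-< {m} {n} k mᵏ<nᵏ with m <? n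
... | yes m<n = m<n
... | no m≮n = contradiction (^-monoˡ-≤ k (≮⇒≥ m≮n)) (<⇒≱ mᵏ<nᵏ)

-- diagForm s is definitionally powerSum s; separating the exponent from the
-- dimension keeps it fixed during induction on the vectors.
powerSum : ∀ {n} → ℕ → Vec ℕ n → Vec ℕ n → ℕ
powerSum k a x = foldr (λ _ → ℕ) _+_ 0 (zipWith (λ aᵢ xᵢ → aᵢ * xᵢ ^ k) a x)

powerSum<⇒All< : ∀ {n} k C {a x : Vec ℕ n} → All (0 <_) a → powerSum k a x < C ^ k → All (_< C) x
powerSum<⇒All< k C {[]} {[]} [] _ = []
powerSum<⇒All< k C {aᵢ ∷ a} {xᵢ ∷ x} (s≤s _ ∷ a>0) sum<Cᵏ =
  ^-cancelʳ-< k xᵢᵏ<Cᵏ ∷ powerSum<⇒All< k C a>0 (≤-<-trans (m≤n+m _ _) sum<Cᵏ)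
  where
  xᵢᵏ<Cᵏ : xᵢ ^ k < C ^ k
  xᵢᵏ<Cᵏ = ≤-<-trans (≤-trans (m≤n*m (xᵢ ^ k) aᵢ) (m≤m+n _ _)) sum<Cᵏ

module _ (M : ℕ) .{{_ : NonZero M}} where

  +-cong-% : ∀ {u u′ v v′} → u % M ≡ u′ % M → v % M ≡ v′ % M → (u + v) % M ≡ (u′ + v′) % M
  +-cong-% {u} {u′} {v} {v′} u≡u′ v≡v′ = begin
    (u + v) % M             ≡⟨ %-distribˡ-+ u v M ⟩
    (u % M + v % M) % M     ≡⟨ cong₂ (λ p q → (p + q) % M) u≡u′ v≡v′ ⟩
    (u′ % M + v′ % M) % M   ≡⟨ %-distribˡ-+ u′ v′ M ⟨
    (u′ + v′) % M           ∎
    where open ≡-Reasoning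

  *-cong-% : ∀ {u u′ v v′} → u % M ≡ u′ % M → v % M ≡ v′ % M → (u * v) % M ≡ (u′ * v′) % M
  *-cong-% {u} {u′} {v} {v′} u≡u′ v≡v′ = begin
    (u * v) % M             ≡⟨ %-distribˡ-* u v M ⟩
    (u % M * (v % M)) % M   ≡⟨ cong₂ (λ p q → (p * q) % M) u≡u′ v≡v′ ⟩
    (u′ % M * (v′ % M)) % M ≡⟨ %-distribˡ-* u′ v′ M ⟨
    (u′ * v′) % M           ∎
    where open ≡-Reasoning

  ^-cong-% : ∀ {u v} k → u % M ≡ v % M → (u ^ k) % M ≡ (v ^ k) % M
  ^-cong-% zero    _   = refl
  ^-cong-% (suc k) u≡v = *-cong-% u≡v (^-cong-% k u≡v)

  powerSum-cong-% : ∀ {n} k (a : Vec ℕ n) {x y} → Pointwise (λ u v → u % M ≡ v % M) x y →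
    powerSum k a x % M ≡ powerSum k a y % M
  powerSum-cong-% k [] [] = refl
  powerSum-cong-% k (aᵢ ∷ a) (xᵢ≡yᵢ ∷ x≡y) =
    +-cong-% (*-cong-% {aᵢ} refl (^-cong-% k xᵢ≡yᵢ)) (powerSum-cong-% k a x≡y)

module Digits (M L : ℕ) .{{_ : NonZero M}} where

  join : ∀ {n} → Vec (Fin M) n → Vec (Fin L) n → Vec ℕ n
  join = zipWith (λ y q → toℕ y + toℕ q * M)

  join-% : ∀ {n} (y : Vec (Fin M) n) q → Pointwise (λ u v → u % M ≡ v % M) (join y q) (Vec.map toℕ y)
  join-% [] [] = []
  join-% (yᵢ ∷ y) (qᵢ ∷ q) = [m+kn]%n≡m%n (toℕ yᵢ) (toℕ qᵢ) M ∷ join-% y q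

  digits : ∀ {n} (x : Vec ℕ n) → All (_< L * M) x → ∃₂ λ y q → join y q ≡ x
  digits [] [] = [] , [] , refl
  digits (xᵢ ∷ x) (xᵢ<LM ∷ x<LM) with digits x x<LM
  ... | y , q , refl = yᵢ ∷ y , qᵢ ∷ q , cong (_∷ join y q) xᵢ-digits
    where
    yᵢ : Fin M
    yᵢ = fromℕ< (m%n<n xᵢ M)
    qᵢ : Fin L
    qᵢ = fromℕ< (m<n*o⇒m/o<n xᵢ<LM)
    xᵢ-digits : toℕ yᵢ + toℕ qᵢ * M ≡ xᵢ
    xᵢ-digits = begin
      toℕ yᵢ + toℕ qᵢ * M  ≡⟨ cong₂ (λ r d → r + d * M) (toℕ-fromℕ< (m%n<n xᵢ M)) (toℕ-fromℕ< (m<n*o⇒m/o<n xᵢ<LM)) ⟩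
      xᵢ % M + xᵢ / M * M  ≡⟨ m≡m%n+[m/n]*n xᵢ M ⟨
      xᵢ                   ∎
      where open ≡-Reasoning

module Candidates {n} (k : ℕ) (a : Vec ℕ n) (M L m : ℕ) .{{_ : NonZero M}} where
  open Digits M L

  residues : List (Vec (Fin M) n)
  residues = filter (λ y → powerSum k a (Vec.map toℕ y) % M ≟ m % M) (allVecs n M)

  candidates : List ℕ
  candidates = concatMap (λ y → List.map (powerSum k a ∘ join y) (allVecs n L)) residues

  length-candidates : length candidates ≡ length residues * L ^ n
  length-candidates = length-concatMap-const _
    (λ y → trans (length-map (powerSum k a ∘ join y) (allVecs n L)) (length-allVecs n L)) residues

  ∈-candidates : All (0 <_) a → ∀ x → powerSum k a x % M ≡ m % M → powerSum k a x < (L * M) ^ k →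
    powerSum k a x ∈ candidates
  ∈-candidates a>0 x x≡m x<[LM]ᵏ with digits x (powerSum<⇒All< k (L * M) a>0 x<[LM]ᵏ)
  ... | y , q , refl = ∈-concatMap⁺ _ (Any.map (λ { refl → ∈-map⁺ _ (∈-allVecs q) }) y∈residues)
    where
    y∈residues : y ∈ residues
    y∈residues = ∈-filter⁺ _ (∈-allVecs y) (trans (sym (powerSum-cong-% M k a (join-% y q))) x≡m)

proposition8p4 : (s : ℕ) → s ≡ 3 ⊎ s ≡ 4 →
    (a : Vec ℕ s) → All (0 <_) a → NonExceptionalIf4 s a →
    (L M m : ℕ) → .{{_ : NonZero M}} → 0 < L → 0 < M → 0 < m → m < M →
    (ns : List ℕ) → Unique ns →
    ListAll.All (λ n → InValues s a n × (∃[ k ] n ≡ m + M * k) × n < L ^ s * M ^ s) ns →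
    length ns ≤ rF s a m M * L ^ s
proposition8p4 s _ a a>0 _ L M m _ _ _ _ ns ns-unique ns-valid = begin
  length ns              ≤⟨ Unique∧⊆⇒length≤ ns-unique ns⊆candidates ⟩
  length candidates      ≡⟨ length-candidates ⟩
  rF s a m M * L ^ s     ∎
  where
  open ≤-Reasoning
  open Candidates s a M L m
  ns⊆candidates : ns ⊆ candidates
  ns⊆candidates n∈ns with ListAll.lookup ns-valid n∈ns
  ... | (x , refl) , (j , Fx≡m+Mj) , Fx<LˢMˢ = ∈-candidates a>0 x
    (trans (cong (_% M) Fx≡m+Mj) (trans (cong (λ t → (m + t) % M) (*-comm M j)) ([m+kn]%n≡m%n m j M)))
    (subst (powerSum s a x <_) (sym (^-distribʳ-* L M s)) Fx<LˢMˢ)
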